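{- Let $s,s'\ge1$, $B:=B(s'\omega_1)\otimes B(s\omega_1)$ of type $A_2$, $C:=B\oplus B'$ a type $A_2$ crystal having $B$ as a direct summand, and $\mathrm{pr}$ a promotion operator on $C$ such that $\mathrm{pr}^k(u)=\mathfrak{pr}^k(u)$ for every $u$ in the inversionless component of $B$ and every $k\ge0$. Then for every $v'\otimes v\in B$ such that $v'$ or $v$ consists of a single repeated letter, $\mathrm{pr}^k(v'\otimes v)=\mathfrak{pr}^k(v'\otimes v)$ for all $k\ge0$.
   Context: Type $A_2$ over $\{1,2,3\}$: $B(s\omega_1)$ is the set of weakly increasing words of length $s$, weight $=$ content. For $i\in\{1,2\}$, $e_i,f_i$ on $v'\otimes v$ act via the bracketing rule on the concatenated word $v'v$ (letters $i\mapsto$ ")", $i+1\mapsto$ "(", match "()"; $f_i$ changes the $i$ of the rightmost unmatched ")" into $i+1$, $e_i$ the $i+1$ of the leftmost unmatched "(" into $i$, else $\emptyset$). A type $A_2$ crystal $C$ here is a disjoint union of tensor products of type $A_2$ highest weight tableau crystals. A promotion operator on $C$ is a map $\mathrm{pr}:C\to C$ with (1) $\mathrm{wt}(b)=(w_1,w_2,w_3)\Rightarrow\mathrm{wt}(\mathrm{pr}(b))=(w_3,w_1,w_2)$; (2) $\mathrm{pr}^3=\mathrm{id}$; (3) $\mathrm{pr}\circ e_1=e_2\circ\mathrm{pr}$, $\mathrm{pr}\circ f_1=f_2\circ\mathrm{pr}$. The canonical promotion on $B$ is $\mathfrak{pr}(v'\otimes v)=\mathfrak{pr}(v')\otimes\mathfrak{pr}(v)$,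 where on a row $v$, $\mathfrak{pr}(v)$ removes the letters $3$, puts that many $0$s at the front and adds $1$ to every letter. The inversionless component of $B$ is the connected component of $B$ (under $e_1,e_2,f_1,f_2$) containing $1^{s'}\otimes 1^s$. -}

module Defs where

open import Data.Nat using (ℕ; zero; suc; _+_; _≤_; _<_)
open import Data.Bool using (Bool; true; false; if_then_else_)
open import Data.List using (List; []; _∷_; _++_; reverse; length; replicate; map; lookup)
open import Data.List.Relation.Unary.All using (All)
open import Data.Maybe using (Maybe; just; nothing)
import Data.Maybe as Maybe
open import Data.Product using (_×_; _,_; Σ; proj₁; proj₂)
open import Data.Unit using (⊤)
open import Data.Empty using (⊥)
open import Data.Fin using (Fin)
open import Relation.Binary.PropositionalEquality using (_≡_)

data Letter : Set where
  L1 L2 L3 : Letter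

eqL : Letter → Letter → Bool
eqL L1 L1 = true
eqL L2 L2 = true
eqL L3 L3 = true
eqL _  _  = false

_<L_ : Letter → Letter → Set
L1 <L L2 = ⊤
L1 <L L3 = ⊤
L2 <L L3 = ⊤
_  <L _  = ⊥

_≤L_ : Letter → Letter → Set
L1 ≤L _  = ⊤
L2 ≤L L1 = ⊥
L2 ≤L _  = ⊤
L3 ≤L L3 = ⊤
L3 ≤L _  = ⊥

Word : Set
Word = List Letter

-- For the pair (a , b) = (i , i+1): a ↦ ")", b ↦ "(".
-- `unmatchedClose a b c w` flags, scanning left to right with c the number
-- of currently unmatched "(", the positions of unmatched ")".

unmatchedClose : Letter → Letter → ℕ → Word → List Bool
unmatchedClose a b c [] = []
unmatchedClose a b c (x ∷ w) with eqL x a | eqL x b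
... | true | _ with c
...   | zero  = true  ∷ unmatchedClose a b zero w
...   | suc d = false ∷ unmatchedClose a b d w
unmatchedClose a b c (x ∷ w) | false | true  = false ∷ unmatchedClose a b (suc c) w
unmatchedClose a b c (x ∷ w) | false | false = false ∷ unmatchedClose a b c w

changeFirst : List Bool → Word → Letter → Maybe Word
changeFirst (true  ∷ fs) (x ∷ w) y = just (y ∷ w)
changeFirst (false ∷ fs) (x ∷ w) y = Maybe.map (x ∷_) (changeFirst fs w y)
changeFirst _ _ _ = nothing

-- f for the pair (a , b): change the a of the rightmost unmatched ")" into b
fW : Letter → Letter → Word → Maybe Word
fW a b w = Maybe.map reverse
  (changeFirst (reverse (unmatchedClose a b 0 w)) (reverse w) b)

-- e for the pair (a , b): change the b of the leftmost unmatched "(" into a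
-- (unmatched "(" are found by scanning right to left with roles swapped)
eW : Letter → Letter → Word → Maybe Word
eW a b w = changeFirst (reverse (unmatchedClose b a 0 (reverse w))) w a

Tab : Set
Tab = Word × Word × Word

Shape : Set
Shape = ℕ × ℕ × ℕ          -- row lengths (λ₁ , λ₂ , λ₃)

IsPartition : Shape → Set
IsPartition (a , b , c) = b ≤ a × c ≤ b

WeakInc : Word → Set
WeakInc [] = ⊤
WeakInc (x ∷ []) = ⊤
WeakInc (x ∷ y ∷ w) = x ≤L y × WeakInc (y ∷ w)

ColStrict : Word → Word → Set
ColStrict _ [] = ⊤
ColStrict [] (_ ∷ _) = ⊥
ColStrict (x ∷ xs) (y ∷ ys) = x <L y × ColStrict xs ys

SSYT : Shape → Tab → Set
SSYT (a , b , c) (r1 , r2 , r3) =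
  length r1 ≡ a × length r2 ≡ b × length r3 ≡ c ×
  WeakInc r1 × WeakInc r2 × WeakInc r3 ×
  ColStrict r1 r2 × ColStrict r2 r3

readTab : Tab → Word
readTab (r1 , r2 , r3) = r3 ++ r2 ++ r1

-- an element of a tensor product t₁ ⊗ ⋯ ⊗ tₙ has word = concatenation
readTabs : List Tab → Word
readTabs [] = []
readTabs (t ∷ ts) = readTab t ++ readTabs ts

takeDrop : ℕ → Word → Word × Word
takeDrop zero w = [] , w
takeDrop (suc n) [] = [] , []
takeDrop (suc n) (x ∷ w) with takeDrop n w
... | (u , v) = (x ∷ u) , v

resplit : List Tab → Word → List Tab
resplit [] w = []
resplit ((r1 , r2 , r3) ∷ ts) w with takeDrop (length r3) w
... | (u3 , w1) with takeDrop (length r2) w1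
...   | (u2 , w2) with takeDrop (length r1) w2
...     | (u1 , w3) = (u1 , u2 , u3) ∷ resplit ts w3

-- A type A_2 crystal C: a direct sum of tensor products of highest weight
-- tableau crystals, given by the list of summands (each a list of shapes).
-- Elements: (index of the summand , list of tableaux).

CrystalData : Set
CrystalData = List (List Shape)

Elt : Set
Elt = ℕ × List Tab

MatchShapes : List Shape → List Tab → Set
MatchShapes [] [] = ⊤
MatchShapes [] (_ ∷ _) = ⊥
MatchShapes (_ ∷ _) [] = ⊥
MatchShapes (λ' ∷ ls) (t ∷ ts) = SSYT λ' t × MatchShapes ls ts

WellFormed : CrystalData → Set
WellFormed Cs = All (All IsPartition) Cs

Valid : CrystalData → Elt → Set
Valid Cs (j , ts) = Σ (j < length Cs) λ p → MatchShapes (lookup Cs (Data.Fin.fromℕ< p)) ts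

liftOp : (Word → Maybe Word) → Elt → Maybe Elt
liftOp op (j , ts) = Maybe.map (λ w → j , resplit ts w) (op (readTabs ts))

e₁ e₂ f₁ f₂ : Elt → Maybe Elt
e₁ = liftOp (eW L1 L2)
e₂ = liftOp (eW L2 L3)
f₁ = liftOp (fW L1 L2)
f₂ = liftOp (fW L2 L3)

count : Letter → Word → ℕ
count a [] = 0
count a (x ∷ w) = if eqL a x then suc (count a w) else count a w

wt : Elt → ℕ × ℕ × ℕ
wt (j , ts) = count L1 (readTabs ts) , count L2 (readTabs ts) , count L3 (readTabs ts)

iter : {A : Set} → (A → A) → ℕ → A → A
iter g zero x = x
iter g (suc k) x = g (iter g k x)

record IsPromotion (Cs : CrystalData) (pr : Elt → Elt) : Set where
  field
    closed : ∀ b → Valid Cs b → Valid Cs (pr b)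
    weight : ∀ b → Valid Cs b → ∀ w₁ w₂ w₃ → wt b ≡ (w₁ , w₂ , w₃) →
             wt (pr b) ≡ (w₃ , w₁ , w₂)
    order3 : ∀ b → Valid Cs b → iter pr 3 b ≡ b
    comm-e : ∀ b → Valid Cs b → Maybe.map pr (e₁ b) ≡ e₂ (pr b)
    comm-f : ∀ b → Valid Cs b → Maybe.map pr (f₁ b) ≡ f₂ (pr b)

rowShape : ℕ → Shape
rowShape s = s , 0 , 0

rowTab : Word → Tab
rowTab v = v , [] , []

pair : ℕ → Word → Word → Elt
pair j v' v = j , rowTab v' ∷ rowTab v ∷ []

removeThrees : Word → Word
removeThrees [] = []
removeThrees (L3 ∷ w) = removeThrees w
removeThrees (x ∷ w) = x ∷ removeThrees w

sucL : Letter → Letter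
sucL L1 = L2
sucL L2 = L3
sucL L3 = L3   -- never used: threes are removed first

prRow : Word → Word
prRow v = replicate (count L3 v) L1 ++ map sucL (removeThrees v)

canonPr : Elt → Elt
canonPr (j , ts) = j , map (λ { (r1 , r2 , r3) → prRow r1 , r2 , r3 }) ts

data Reach (x : Elt) : Elt → Set where
  here : Reach x x
  by-e₁ : ∀ {y z} → Reach x y → e₁ y ≡ just z → Reach x z
  by-e₂ : ∀ {y z} → Reach x y → e₂ y ≡ just z → Reach x z
  by-f₁ : ∀ {y z} → Reach x y → f₁ y ≡ just z → Reach x z
  by-f₂ : ∀ {y z} → Reach x y → f₂ y ≡ just z → Reach x z

Inversionless : ℕ → ℕ → ℕ → Elt → Set
Inversionless j s' s u = Reach (pair j (replicate s' L1) (replicate s L1)) u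

SingleLetter : Word → Set
SingleLetter v = Σ Letter λ a → v ≡ replicate (length v) a

-- The inversionless component contains every v' ⊗ v whose concatenation v'v is weakly
-- increasing, 1^a 2^b 3^c with a + b + c = s' + s: starting from 1^{s'} ⊗ 1^s, f₁ turns the last
-- 1 of v'v into a 2 and f₂ the last 2 into a 3, which reaches every such content.  On a row,
-- 𝔭𝔯 sends 1^a 2^b 3^c to 1^c 2^a 3^b.  Hence if v' = ℓ^{s'}, then v' ⊗ v = 𝔭𝔯ⁿ (1^{s'} ⊗ u) for
-- some n fixed by ℓ and some weakly increasing u; if v = ℓ^s, then v' ⊗ v = 𝔭𝔯ⁿ (u ⊗ 3^s).
-- Either preimage b is inversionless, and prᵏ (𝔭𝔯ⁿ b) = prᵏ (prⁿ b) = pr^{k+n} b = 𝔭𝔯^{k+n} b.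

module Submission where

open import Defs
open import Data.Nat using (ℕ; zero; suc; _+_; _≤_; _<_; _⊓_; _∸_)
open import Data.Nat.Properties using (+-suc; +-assoc; +-identityʳ)
open import Data.Bool using (true; false)
open import Data.List using (List; []; _∷_; _++_; _∷ʳ_; length; lookup; replicate; reverse; map; take; drop)
open import Data.List.Properties
  using (++-identityʳ; ++-assoc; length-++; length-map; length-replicate; length-reverse; length-take; length-drop;
         reverse-++; unfold-reverse; reverse-involutive; take++drop≡id)
open import Data.Maybe using (Maybe; just)
import Data.Maybe as Maybe
open import Data.Fin using (fromℕ<)
open import Data.Product using (_×_; _,_; Σ; ∃; proj₁)
open import Data.Sum using (_⊎_; inj₁; inj₂)
open import Data.Empty using (⊥-elim)
open import Relation.Binary.PropositionalEquality
open ≡-Reasoning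

replicate-+ : ∀ {A : Set} m n (x : A) → replicate (m + n) x ≡ replicate m x ++ replicate n x
replicate-+ zero    n x = refl
replicate-+ (suc m) n x = cong (x ∷_) (replicate-+ m n x)

replicate-∷-++ : ∀ {A : Set} n (x : A) w → replicate (suc n) x ++ w ≡ replicate n x ++ x ∷ w
replicate-∷-++ zero    x w = refl
replicate-∷-++ (suc n) x w = cong (x ∷_) (replicate-∷-++ n x w)

reverse-replicate : ∀ {A : Set} n (x : A) → reverse (replicate n x) ≡ replicate n x
reverse-replicate zero    x = refl
reverse-replicate (suc n) x = begin
  reverse (x ∷ replicate n x)  ≡⟨ unfold-reverse x (replicate n x) ⟩
  reverse (replicate n x) ∷ʳ x ≡⟨ cong (_∷ʳ x) (reverse-replicate n x) ⟩
  replicate n x ∷ʳ x           ≡⟨ replicate-∷-++ n x [] ⟨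
  x ∷ replicate n x ++ []      ≡⟨ ++-identityʳ _ ⟩
  x ∷ replicate n x            ∎

reverse-++-∷ : ∀ {A : Set} (u : List A) x v → reverse (u ++ x ∷ v) ≡ reverse v ++ x ∷ reverse u
reverse-++-∷ u x v = begin
  reverse (u ++ x ∷ v)            ≡⟨ reverse-++ u (x ∷ v) ⟩
  reverse (x ∷ v) ++ reverse u    ≡⟨ cong (_++ reverse u) (unfold-reverse x v) ⟩
  (reverse v ∷ʳ x) ++ reverse u   ≡⟨ ++-assoc (reverse v) (x ∷ []) (reverse u) ⟩
  reverse v ++ x ∷ reverse u      ∎

iter-+ : ∀ {A : Set} (g : A → A) k n x → iter g (k + n) x ≡ iter g k (iter g n x)
iter-+ g zero    n x = refl
iter-+ g (suc k) n x = cong g (iter-+ g k n x)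

Triple : Set
Triple = ℕ × ℕ × ℕ

sorted : Triple → Word
sorted (a , b , c) = replicate a L1 ++ replicate b L2 ++ replicate c L3

length-sorted : ∀ a b c → length (sorted (a , b , c)) ≡ a + (b + c)
length-sorted a b c = begin
  length (sorted (a , b , c))
    ≡⟨ length-++ (replicate a L1) ⟩
  length (replicate a L1) + length (replicate b L2 ++ replicate c L3)
    ≡⟨ cong (length (replicate a L1) +_) (length-++ (replicate b L2)) ⟩
  length (replicate a L1) + (length (replicate b L2) + length (replicate c L3))
    ≡⟨ cong₂ _+_ (length-replicate a) (cong₂ _+_ (length-replicate b) (length-replicate c)) ⟩
  a + (b + c) ∎

sorted-∷ : ∀ {x y w} a b c → x ≤L y → y ∷ w ≡ sorted (a , b , c) → ∃ λ t → x ∷ y ∷ w ≡ sorted t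
sorted-∷ {L1} a       b       c _  eq   = (suc a , b , c) , cong (L1 ∷_) eq
sorted-∷ {L2} zero    b       c _  eq   = (0 , suc b , c) , cong (L2 ∷_) eq
sorted-∷ {L2} (suc a) b       c le refl = ⊥-elim le
sorted-∷ {L3} zero    zero    c _  eq   = (0 , 0 , suc c) , cong (L3 ∷_) eq
sorted-∷ {L3} zero    (suc b) c le refl = ⊥-elim le
sorted-∷ {L3} (suc a) b       c le refl = ⊥-elim le

weakInc⇒sorted : ∀ w → WeakInc w → ∃ λ t → w ≡ sorted t
weakInc⇒sorted []            _ = (0 , 0 , 0) , refl
weakInc⇒sorted (L1 ∷ [])     _ = (1 , 0 , 0) , refl
weakInc⇒sorted (L2 ∷ [])     _ = (0 , 1 , 0) , refl
weakInc⇒sorted (L3 ∷ [])     _ = (0 , 0 , 1) , refl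
weakInc⇒sorted (x ∷ y ∷ w) (x≤y , inc) with weakInc⇒sorted (y ∷ w) inc
... | (a , b , c) , eq = sorted-∷ a b c x≤y eq

rotate : Triple → Triple
rotate (a , b , c) = c , a , b

count-L3-sorted : ∀ a b c → count L3 (sorted (a , b , c)) ≡ c
count-L3-sorted (suc a) b       c       = count-L3-sorted a b c
count-L3-sorted zero    (suc b) c       = count-L3-sorted 0 b c
count-L3-sorted zero    zero    (suc c) = cong suc (count-L3-sorted 0 0 c)
count-L3-sorted zero    zero    zero    = refl

map-sucL-removeThrees-sorted : ∀ a b c → map sucL (removeThrees (sorted (a , b , c))) ≡ sorted (0 , a , b)
map-sucL-removeThrees-sorted (suc a) b       c       = cong (L2 ∷_) (map-sucL-removeThrees-sorted a b c)
map-sucL-removeThrees-sorted zero    (suc b) c       = cong (L3 ∷_) (map-sucL-removeThrees-sorted 0 b c)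
map-sucL-removeThrees-sorted zero    zero    (suc c) = map-sucL-removeThrees-sorted 0 0 c
map-sucL-removeThrees-sorted zero    zero    zero    = refl

prRow-sorted : ∀ t → prRow (sorted t) ≡ sorted (rotate t)
prRow-sorted (a , b , c) =
  cong₂ (λ n w → replicate n L1 ++ w) (count-L3-sorted a b c) (map-sucL-removeThrees-sorted a b c)

iter-prRow-sorted : ∀ n t → iter prRow n (sorted t) ≡ sorted (iter rotate n t)
iter-prRow-sorted zero    t = refl
iter-prRow-sorted (suc n) t = trans (cong prRow (iter-prRow-sorted n t)) (prRow-sorted (iter rotate n t))

-- rotate has order 3, so rotate (rotate t) is a preimage of t
iter-rotate-surjective : ∀ n t → ∃ λ t' → iter rotate n t' ≡ t
iter-rotate-surjective zero    t = t , refl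
iter-rotate-surjective (suc n) t with iter-rotate-surjective n (rotate (rotate t))
... | t' , eq = t' , cong rotate eq

length-prRow : ∀ w → length (prRow w) ≡ length w
length-prRow w = begin
  length (replicate (count L3 w) L1 ++ map sucL (removeThrees w))
    ≡⟨ length-++ (replicate (count L3 w) L1) ⟩
  length (replicate (count L3 w) L1) + length (map sucL (removeThrees w))
    ≡⟨ cong₂ _+_ (length-replicate (count L3 w)) (length-map sucL (removeThrees w)) ⟩
  count L3 w + length (removeThrees w)
    ≡⟨ threes+rest w ⟩
  length w ∎
  where
  threes+rest : ∀ w → count L3 w + length (removeThrees w) ≡ length w
  threes+rest []       = refl
  threes+rest (L1 ∷ w) = trans (+-suc (count L3 w) _) (cong suc (threes+rest w))
  threes+rest (L2 ∷ w) = trans (+-suc (count L3 w) _) (cong suc (threes+rest w))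
  threes+rest (L3 ∷ w) = cong suc (threes+rest w)

length-iter-prRow : ∀ n w → length (iter prRow n w) ≡ length w
length-iter-prRow zero    w = refl
length-iter-prRow (suc n) w = trans (length-prRow (iter prRow n w)) (length-iter-prRow n w)

changeFirst-atFirstTrue : ∀ (u : Word) x v fs y →
  changeFirst (replicate (length u) false ++ true ∷ fs) (u ++ x ∷ v) y ≡ just (u ++ y ∷ v)
changeFirst-atFirstTrue []      x v fs y = refl
changeFirst-atFirstTrue (z ∷ u) x v fs y = cong (Maybe.map (z ∷_)) (changeFirst-atFirstTrue u x v fs y)

fW-atLastUnmatched : ∀ a b w₁ x w₂ fs →
  unmatchedClose a b 0 (w₁ ++ x ∷ w₂) ≡ fs ++ true ∷ replicate (length w₂) false →
  fW a b (w₁ ++ x ∷ w₂) ≡ just (w₁ ++ b ∷ w₂)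
fW-atLastUnmatched a b w₁ x w₂ fs flags = begin
  Maybe.map reverse (changeFirst (reverse (unmatchedClose a b 0 (w₁ ++ x ∷ w₂))) (reverse (w₁ ++ x ∷ w₂)) b)
    ≡⟨ cong₂ (λ gs w → Maybe.map reverse (changeFirst gs w b)) reversedFlags (reverse-++-∷ w₁ x w₂) ⟩
  Maybe.map reverse (changeFirst (replicate (length (reverse w₂)) false ++ true ∷ reverse fs)
                                 (reverse w₂ ++ x ∷ reverse w₁) b)
    ≡⟨ cong (Maybe.map reverse) (changeFirst-atFirstTrue (reverse w₂) x (reverse w₁) (reverse fs) b) ⟩
  just (reverse (reverse w₂ ++ b ∷ reverse w₁))
    ≡⟨ cong just (reverse-++-∷ (reverse w₂) b (reverse w₁)) ⟩
  just (reverse (reverse w₁) ++ b ∷ reverse (reverse w₂))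
    ≡⟨ cong₂ (λ u v → just (u ++ b ∷ v)) (reverse-involutive w₁) (reverse-involutive w₂) ⟩
  just (w₁ ++ b ∷ w₂) ∎
  where
  reversedFlags : reverse (unmatchedClose a b 0 (w₁ ++ x ∷ w₂))
                ≡ replicate (length (reverse w₂)) false ++ true ∷ reverse fs
  reversedFlags = begin
    reverse (unmatchedClose a b 0 (w₁ ++ x ∷ w₂))
      ≡⟨ cong reverse flags ⟩
    reverse (fs ++ true ∷ replicate (length w₂) false)
      ≡⟨ reverse-++-∷ fs true _ ⟩
    reverse (replicate (length w₂) false) ++ true ∷ reverse fs
      ≡⟨ cong (_++ true ∷ reverse fs) (reverse-replicate (length w₂) false) ⟩
    replicate (length w₂) false ++ true ∷ reverse fs
      ≡⟨ cong (λ n → replicate n false ++ true ∷ reverse fs) (length-reverse w₂) ⟨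
    replicate (length (reverse w₂)) false ++ true ∷ reverse fs ∎

unmatched₁₂-ones : ∀ n w → unmatchedClose L1 L2 0 (replicate n L1 ++ w) ≡ replicate n true ++ unmatchedClose L1 L2 0 w
unmatched₁₂-ones zero    w = refl
unmatched₁₂-ones (suc n) w = cong (true ∷_) (unmatched₁₂-ones n w)

unmatched₁₂-noOnes : ∀ c b d → unmatchedClose L1 L2 c (sorted (0 , b , d)) ≡ replicate (length (sorted (0 , b , d))) false
unmatched₁₂-noOnes c (suc b) d       = cong (false ∷_) (unmatched₁₂-noOnes (suc c) b d)
unmatched₁₂-noOnes c zero    (suc d) = cong (false ∷_) (unmatched₁₂-noOnes c 0 d)
unmatched₁₂-noOnes c zero    zero    = refl

unmatched₂₃-ones : ∀ n w → unmatchedClose L2 L3 0 (replicate n L1 ++ w) ≡ replicate n false ++ unmatchedClose L2 L3 0 w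
unmatched₂₃-ones zero    w = refl
unmatched₂₃-ones (suc n) w = cong (false ∷_) (unmatched₂₃-ones n w)

unmatched₂₃-twos : ∀ n w → unmatchedClose L2 L3 0 (replicate n L2 ++ w) ≡ replicate n true ++ unmatchedClose L2 L3 0 w
unmatched₂₃-twos zero    w = refl
unmatched₂₃-twos (suc n) w = cong (true ∷_) (unmatched₂₃-twos n w)

unmatched₂₃-threes : ∀ c n → unmatchedClose L2 L3 c (replicate n L3) ≡ replicate (length (replicate n L3)) false
unmatched₂₃-threes c zero    = refl
unmatched₂₃-threes c (suc n) = cong (false ∷_) (unmatched₂₃-threes (suc c) n)

f₁-sorted : ∀ a b c → fW L1 L2 (sorted (suc a , b , c)) ≡ just (sorted (a , suc b , c))
f₁-sorted a b c = begin
  fW L1 L2 (sorted (suc a , b , c))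
    ≡⟨ cong (fW L1 L2) (replicate-∷-++ a L1 rest) ⟩
  fW L1 L2 (replicate a L1 ++ L1 ∷ rest)
    ≡⟨ fW-atLastUnmatched L1 L2 (replicate a L1) L1 rest (replicate a true)
         (trans (unmatched₁₂-ones a (L1 ∷ rest)) (cong (λ fs → replicate a true ++ true ∷ fs) (unmatched₁₂-noOnes 0 b c))) ⟩
  just (sorted (a , suc b , c)) ∎
  where
  rest : Word
  rest = sorted (0 , b , c)

f₂-sorted : ∀ a b c → fW L2 L3 (sorted (a , suc b , c)) ≡ just (sorted (a , b , suc c))
f₂-sorted a b c = begin
  fW L2 L3 (sorted (a , suc b , c))
    ≡⟨ cong (fW L2 L3) split ⟩
  fW L2 L3 (prefix ++ L2 ∷ replicate c L3)
    ≡⟨ fW-atLastUnmatched L2 L3 prefix L2 (replicate c L3) (replicate a false ++ replicate b true) flags ⟩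
  just (prefix ++ L3 ∷ replicate c L3)
    ≡⟨ cong just (++-assoc (replicate a L1) (replicate b L2) (L3 ∷ replicate c L3)) ⟩
  just (sorted (a , b , suc c)) ∎
  where
  prefix : Word
  prefix = replicate a L1 ++ replicate b L2
  split : sorted (a , suc b , c) ≡ prefix ++ L2 ∷ replicate c L3
  split = trans (cong (replicate a L1 ++_) (replicate-∷-++ b L2 (replicate c L3)))
                (sym (++-assoc (replicate a L1) (replicate b L2) _))
  flags : unmatchedClose L2 L3 0 (prefix ++ L2 ∷ replicate c L3)
        ≡ (replicate a false ++ replicate b true) ++ true ∷ replicate (length (replicate c L3)) false
  flags = begin
    unmatchedClose L2 L3 0 (prefix ++ L2 ∷ replicate c L3)
      ≡⟨ cong (unmatchedClose L2 L3 0) (++-assoc (replicate a L1) (replicate b L2) _) ⟩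
    unmatchedClose L2 L3 0 (replicate a L1 ++ replicate b L2 ++ L2 ∷ replicate c L3)
      ≡⟨ unmatched₂₃-ones a _ ⟩
    replicate a false ++ unmatchedClose L2 L3 0 (replicate b L2 ++ L2 ∷ replicate c L3)
      ≡⟨ cong (replicate a false ++_) (unmatched₂₃-twos b _) ⟩
    replicate a false ++ replicate b true ++ true ∷ unmatchedClose L2 L3 0 (replicate c L3)
      ≡⟨ cong (λ fs → replicate a false ++ replicate b true ++ true ∷ fs) (unmatched₂₃-threes 0 c) ⟩
    replicate a false ++ replicate b true ++ true ∷ replicate (length (replicate c L3)) false
      ≡⟨ ++-assoc (replicate a false) (replicate b true) _ ⟨
    (replicate a false ++ replicate b true) ++ true ∷ replicate (length (replicate c L3)) false ∎

takeDrop-++ : ∀ (x y : Word) → takeDrop (length x) (x ++ y) ≡ (x , y)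
takeDrop-++ []      y = refl
takeDrop-++ (a ∷ x) y rewrite takeDrop-++ x y = refl

takeDrop-length : ∀ (y : Word) → takeDrop (length y) y ≡ (y , [])
takeDrop-length y = subst (λ w → takeDrop (length y) w ≡ (y , [])) (++-identityʳ y) (takeDrop-++ y [])

resplit-rows : ∀ x y x' y' → length x ≡ length x' → length y ≡ length y' →
  resplit (rowTab x ∷ rowTab y ∷ []) (x' ++ y') ≡ rowTab x' ∷ rowTab y' ∷ []
resplit-rows x y x' y' lx ly rewrite lx | ly | takeDrop-++ x' y' | takeDrop-length y' = refl

liftOp-pair : ∀ (op : Word → Maybe Word) j x y x' y' → op (x ++ y) ≡ just (x' ++ y') →
  length x ≡ length x' → length y ≡ length y' → liftOp op (pair j x y) ≡ just (pair j x' y')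
liftOp-pair op j x y x' y' eq lx ly
  rewrite ++-identityʳ y | eq = cong (λ ts → just (j , ts)) (resplit-rows x y x' y' lx ly)

module _ (j s' : ℕ) where

  cutPair : Word → Elt
  cutPair w = pair j (take s' w) (drop s' w)

  cutPair-++ : ∀ x y → length x ≡ s' → cutPair (x ++ y) ≡ pair j x y
  cutPair-++ x y refl = cong₂ (pair j) (take-length x) (drop-length x)
    where
    take-length : ∀ x → take (length x) (x ++ y) ≡ x
    take-length []      = refl
    take-length (a ∷ x) = cong (a ∷_) (take-length x)
    drop-length : ∀ x → drop (length x) (x ++ y) ≡ y
    drop-length []      = refl
    drop-length (a ∷ x) = drop-length x

  liftOp-cutPair : ∀ (op : Word → Maybe Word) w w' → op w ≡ just w' → length w ≡ length w' →
    liftOp op (cutPair w) ≡ just (cutPair w')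
  liftOp-cutPair op w w' eq lw = liftOp-pair op j (take s' w) (drop s' w) (take s' w') (drop s' w')
    (trans (cong op (take++drop≡id s' w)) (trans eq (cong just (sym (take++drop≡id s' w')))))
    (trans (length-take s' w) (trans (cong (s' ⊓_) lw) (sym (length-take s' w'))))
    (trans (length-drop s' w) (trans (cong (_∸ s') lw) (sym (length-drop s' w'))))

module _ (j s' s : ℕ) where

  Reachable : Triple → Set
  Reachable t = Inversionless j s' s (cutPair j s' (sorted t))

  reachable-f₁ : ∀ a b c → Reachable (suc a , b , c) → Reachable (a , suc b , c)
  reachable-f₁ a b c r = by-f₁ r (liftOp-cutPair j s' (fW L1 L2) _ _ (f₁-sorted a b c) lengths)
    where
    lengths : length (sorted (suc a , b , c)) ≡ length (sorted (a , suc b , c))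
    lengths = trans (length-sorted (suc a) b c) (trans (sym (+-suc a (b + c))) (sym (length-sorted a (suc b) c)))

  reachable-f₂ : ∀ a b c → Reachable (a , suc b , c) → Reachable (a , b , suc c)
  reachable-f₂ a b c r = by-f₂ r (liftOp-cutPair j s' (fW L2 L3) _ _ (f₂-sorted a b c) lengths)
    where
    lengths : length (sorted (a , suc b , c)) ≡ length (sorted (a , b , suc c))
    lengths = trans (length-sorted a (suc b) c) (trans (cong (a +_) (sym (+-suc b c))) (sym (length-sorted a b (suc c))))

  reachable-threes : ∀ c a → Reachable (a + c , 0 , 0) → Reachable (a , 0 , c)
  reachable-threes zero    a r = subst (λ n → Reachable (n , 0 , 0)) (+-identityʳ a) r
  reachable-threes (suc c) a r =
    reachable-f₂ a 0 c (reachable-f₁ a 0 c (reachable-threes c (suc a) (subst (λ n → Reachable (n , 0 , 0)) (+-suc a c) r)))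

  reachable-twos : ∀ b a c → Reachable (a + b , 0 , c) → Reachable (a , b , c)
  reachable-twos zero    a c r = subst (λ n → Reachable (n , 0 , c)) (+-identityʳ a) r
  reachable-twos (suc b) a c r =
    reachable-f₁ a b c (reachable-twos b (suc a) c (subst (λ n → Reachable (n , 0 , c)) (+-suc a b) r))

  reachable-start : Reachable (s' + s , 0 , 0)
  reachable-start = subst (Inversionless j s' s) (sym start) here
    where
    start : cutPair j s' (sorted (s' + s , 0 , 0)) ≡ pair j (replicate s' L1) (replicate s L1)
    start = trans (cong (cutPair j s') (trans (++-identityʳ _) (replicate-+ s' s L1)))
                  (cutPair-++ j s' (replicate s' L1) (replicate s L1) (length-replicate s'))

  reachable-sorted : ∀ a b c → a + (b + c) ≡ s' + s → Reachable (a , b , c)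
  reachable-sorted a b c total =
    reachable-twos b a c (reachable-threes c (a + b)
      (subst (λ n → Reachable (n , 0 , 0)) (trans (sym total) (sym (+-assoc a b c))) reachable-start))

  sortedConcat-inversionless : ∀ x y t → length x ≡ s' → length y ≡ s → x ++ y ≡ sorted t →
    Inversionless j s' s (pair j x y)
  sortedConcat-inversionless x y (a , b , c) lx ly eq =
    subst (Inversionless j s' s) (trans (cong (cutPair j s') (sym eq)) (cutPair-++ j s' x y lx))
      (reachable-sorted a b c total)
    where
    total : a + (b + c) ≡ s' + s
    total = trans (sym (length-sorted a b c)) (trans (cong length (sym eq)) (trans (length-++ x) (cong₂ _+_ lx ly)))

position : Letter → ℕ
position L1 = 0
position L2 = 1
position L3 = 2

replicate-from-ones : ∀ ℓ m → replicate m ℓ ≡ sorted (iter rotate (position ℓ) (m , 0 , 0))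
replicate-from-ones L1 m = sym (++-identityʳ (replicate m L1))
replicate-from-ones L2 m = sym (++-identityʳ (replicate m L2))
replicate-from-ones L3 m = refl

replicate-from-threes : ∀ ℓ m → replicate m ℓ ≡ sorted (iter rotate (suc (position ℓ)) (0 , 0 , m))
replicate-from-threes L1 m = sym (++-identityʳ (replicate m L1))
replicate-from-threes L2 m = sym (++-identityʳ (replicate m L2))
replicate-from-threes L3 m = refl

ones-++-sorted : ∀ m a b c → replicate m L1 ++ sorted (a , b , c) ≡ sorted (m + a , b , c)
ones-++-sorted m a b c = begin
  replicate m L1 ++ replicate a L1 ++ replicate b L2 ++ replicate c L3
    ≡⟨ ++-assoc (replicate m L1) (replicate a L1) _ ⟨
  (replicate m L1 ++ replicate a L1) ++ replicate b L2 ++ replicate c L3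
    ≡⟨ cong (_++ replicate b L2 ++ replicate c L3) (replicate-+ m a L1) ⟨
  sorted (m + a , b , c) ∎

sorted-++-threes : ∀ a b c m → sorted (a , b , c) ++ replicate m L3 ≡ sorted (a , b , c + m)
sorted-++-threes a b c m = begin
  (replicate a L1 ++ replicate b L2 ++ replicate c L3) ++ replicate m L3
    ≡⟨ ++-assoc (replicate a L1) _ _ ⟩
  replicate a L1 ++ (replicate b L2 ++ replicate c L3) ++ replicate m L3
    ≡⟨ cong (replicate a L1 ++_) (++-assoc (replicate b L2) _ _) ⟩
  replicate a L1 ++ replicate b L2 ++ replicate c L3 ++ replicate m L3
    ≡⟨ cong (λ w → replicate a L1 ++ replicate b L2 ++ w) (replicate-+ c m L3) ⟨
  sorted (a , b , c + m) ∎

PromotedFromSorted : Word → Word → Set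
PromotedFromSorted v' v =
  Σ ℕ λ n → Σ Word λ x → Σ Word λ y → Σ Triple λ t →
    x ++ y ≡ sorted t × iter prRow n x ≡ v' × iter prRow n y ≡ v

promotedFromSorted : ∀ v' v → WeakInc v' → WeakInc v → SingleLetter v' ⊎ SingleLetter v → PromotedFromSorted v' v
promotedFromSorted v' v _ inc (inj₁ (ℓ , v'≡ℓᵐ)) with weakInc⇒sorted v inc
... | t , v≡t with iter-rotate-surjective (position ℓ) t
...   | (a , b , c) , rot≡t =
  position ℓ , replicate m L1 , sorted (a , b , c) , (m + a , b , c) ,
  ones-++-sorted m a b c ,
  (begin
    iter prRow (position ℓ) (replicate m L1)                  ≡⟨ cong (iter prRow (position ℓ)) (replicate-from-ones L1 m) ⟩
    iter prRow (position ℓ) (sorted (m , 0 , 0))              ≡⟨ iter-prRow-sorted (position ℓ) (m , 0 , 0) ⟩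
    sorted (iter rotate (position ℓ) (m , 0 , 0))             ≡⟨ replicate-from-ones ℓ m ⟨
    replicate m ℓ                                             ≡⟨ v'≡ℓᵐ ⟨
    v'                                                        ∎) ,
  (begin
    iter prRow (position ℓ) (sorted (a , b , c))              ≡⟨ iter-prRow-sorted (position ℓ) (a , b , c) ⟩
    sorted (iter rotate (position ℓ) (a , b , c))             ≡⟨ cong sorted rot≡t ⟩
    sorted t                                                  ≡⟨ v≡t ⟨
    v                                                         ∎)
  where
  m = length v'
promotedFromSorted v' v inc _ (inj₂ (ℓ , v≡ℓᵐ)) with weakInc⇒sorted v' inc
... | t , v'≡t with iter-rotate-surjective (suc (position ℓ)) t
...   | (a , b , c) , rot≡t =
  suc (position ℓ) , sorted (a , b , c) , replicate m L3 , (a , b , c + m) ,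
  sorted-++-threes a b c m ,
  (begin
    iter prRow (suc (position ℓ)) (sorted (a , b , c))        ≡⟨ iter-prRow-sorted (suc (position ℓ)) (a , b , c) ⟩
    sorted (iter rotate (suc (position ℓ)) (a , b , c))       ≡⟨ cong sorted rot≡t ⟩
    sorted t                                                  ≡⟨ v'≡t ⟨
    v'                                                        ∎) ,
  (begin
    iter prRow (suc (position ℓ)) (sorted (0 , 0 , m))        ≡⟨ iter-prRow-sorted (suc (position ℓ)) (0 , 0 , m) ⟩
    sorted (iter rotate (suc (position ℓ)) (0 , 0 , m))       ≡⟨ replicate-from-threes ℓ m ⟨
    replicate m ℓ                                             ≡⟨ v≡ℓᵐ ⟨
    v                                                         ∎)
  where
  m = length v

iter-canonPr-pair : ∀ j n x y → iter canonPr n (pair j x y) ≡ pair j (iter prRow n x) (iter prRow n y)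
iter-canonPr-pair j zero    x y = refl
iter-canonPr-pair j (suc n) x y = cong canonPr (iter-canonPr-pair j n x y)

iter-agree-onOrbit : ∀ {A : Set} (g h : A → A) x → (∀ k → iter g k x ≡ iter h k x) →
  ∀ n k → iter g k (iter h n x) ≡ iter h k (iter h n x)
iter-agree-onOrbit g h x agree n k = begin
  iter g k (iter h n x) ≡⟨ cong (iter g k) (agree n) ⟨
  iter g k (iter g n x) ≡⟨ iter-+ g k n x ⟨
  iter g (k + n) x      ≡⟨ agree (k + n) ⟩
  iter h (k + n) x      ≡⟨ iter-+ h k n x ⟩
  iter h k (iter h n x) ∎

lemma4p4 : (s' s : ℕ) → 1 ≤ s' → 1 ≤ s →
    (Cs : CrystalData) → WellFormed Cs →
    (j : ℕ) (jp : j < length Cs) →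
    lookup Cs (fromℕ< jp) ≡ rowShape s' ∷ rowShape s ∷ [] →
    (pr : Elt → Elt) → IsPromotion Cs pr →
    (∀ u → Inversionless j s' s u → ∀ k → iter pr k u ≡ iter canonPr k u) →
    ∀ v' v → length v' ≡ s' → length v ≡ s → WeakInc v' → WeakInc v →
    SingleLetter v' ⊎ SingleLetter v →
    ∀ k → iter pr k (pair j v' v) ≡ iter canonPr k (pair j v' v)
lemma4p4 s' s _ _ _ _ j _ _ pr _ agree v' v |v'| |v| inc' inc single k
  with promotedFromSorted v' v inc' inc single
... | n , x , y , t , x++y≡t , prⁿx≡v' , prⁿy≡v =
  subst (λ b → iter pr k b ≡ iter canonPr k b) promoted
    (iter-agree-onOrbit pr canonPr (pair j x y) (agree (pair j x y) inversionless) n k)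
  where
  inversionless : Inversionless j s' s (pair j x y)
  inversionless = sortedConcat-inversionless j s' s x y t
    (trans (sym (length-iter-prRow n x)) (trans (cong length prⁿx≡v') |v'|))
    (trans (sym (length-iter-prRow n y)) (trans (cong length prⁿy≡v) |v|))
    x++y≡t
  promoted : iter canonPr n (pair j x y) ≡ pair j v' v
  promoted = trans (iter-canonPr-pair j n x y) (cong₂ (pair j) prⁿx≡v' prⁿy≡v)
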